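{- Let $p\ge7$ be a prime and let $A=\{a_1,a_2\}\subseteq\mathbf{F}_p^{\ast}$ with $a_1\ne a_2$. Let $G=(\mathbf{F}_p,E_A)$ be the Cayley graph with $E_A=\{(x,x+a):x\in\mathbf{F}_p,\ a\in A\}$. If $G$ is triangle-free, then \[ \beta(G)\le\frac{p-1}{2}\le\frac{\gamma(G)}{2}. \]
   Context: $\mathbf{F}_p=\mathbf{Z}/p\mathbf{Z}$, $\mathbf{F}_p^\ast=\mathbf{F}_p\setminus\{0\}$. In a directed graph $(V,E)$ with $E\subseteq V\times V$, a directed cycle of length $n\ge1$ is a sequence of vertices $w_0,\ldots,w_n$ with $(w_j,w_{j+1})\in E$ for all $j$ and $w_n=w_0$; loops, digons and triangles are directed cycles of length 1, 2, 3 respectively. The graph is triangle-free (3-free) if it has no loop, digon or triangle, and directed acyclic if it has no directed cycle. $\beta(G)$ is the minimum size of a set $X$ of edges such that $(V,E\setminus X)$ is directed acyclic. $\gamma(G)$ is the number of unordered pairs of distinct vertices that are nonadjacent in the undirected graph obtained from $G$ by replacing each directed edge by an undirected edge. -}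

module Defs where

open import Data.Nat using (ℕ; zero; suc; _+_; _*_; _∸_; _≤_; _<_; NonZero)
open import Data.Nat.DivMod using (_%_; m%n<n)
open import Data.Nat.Primality using (Prime)
open import Data.Fin using (Fin; toℕ; fromℕ<)
open import Data.Fin.Properties using (_≟_)
open import Data.Product using (Σ; ∃; _×_; _,_)
open import Data.List using (List; []; _∷_; length; filter; allFin; concatMap; map)
open import Data.List.Membership.Propositional using (_∈_)
open import Data.List.Relation.Unary.All using (All)
open import Data.Vec using (Vec; lookup; head; last)
open import Relation.Nullary using (¬_; Dec; yes; no)
open import Relation.Nullary.Decidable using (_×-dec_; _⊎-dec_; ¬?)
open import Data.Nat using (_<?_)
open import Relation.Unary using (Decidable)
open import Relation.Binary.PropositionalEquality using (_≡_)
open import Data.Sum using (_⊎_)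

Digraph : ℕ → Set₁
Digraph n = Fin n → Fin n → Set

record DirCycle {n : ℕ} (E : Digraph n) (k : ℕ) : Set where
  field
    w      : Fin (suc k) → Fin n
    edges  : (j : Fin k) → E (w (Data.Fin.inject₁ j)) (w (Data.Fin.suc j))
    closed : w (Data.Fin.fromℕ k) ≡ w Data.Fin.zero

TriangleFree : {n : ℕ} → Digraph n → Set
TriangleFree E = ¬ DirCycle E 1 × ¬ DirCycle E 2 × ¬ DirCycle E 3

Acyclic : {n : ℕ} → Digraph n → Set
Acyclic E = (k : ℕ) → ¬ DirCycle E (suc k)

_∖_ : {n : ℕ} → Digraph n → List (Fin n × Fin n) → Digraph n
(E ∖ X) x y = E x y × ¬ ((x , y) ∈ X)

-- β(G) ≤ b : there is a set X ⊆ E of at most b edges with (V, E ∖ X) acyclic.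
-- (β is the minimum of such sizes, so this is exactly "β(G) ≤ b"; a list with
-- repetitions only overstates the size of the set it represents.)
β≤ : {n : ℕ} → Digraph n → ℕ → Set
β≤ E b = Σ (List _) λ X → All (λ e → E (Data.Product.proj₁ e) (Data.Product.proj₂ e)) X
                        × length X ≤ b × Acyclic (E ∖ X)

Adjacent : {n : ℕ} → Digraph n → Fin n → Fin n → Set
Adjacent E x y = E x y ⊎ E y x

-- Unordered pairs of distinct vertices are enumerated as
-- ordered pairs (x , y) with toℕ x < toℕ y.
γ : {n : ℕ} (E : Digraph n) → (∀ x y → Dec (E x y)) → ℕ
γ {n} E dec = length (filter nonadj pairs)
  where
    pairs : List (Fin n × Fin n)
    pairs = concatMap (λ x → map (λ y → x , y) (allFin n)) (allFin n)
    nonadj : Decidable (λ (e : Fin n × Fin n) →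
               (toℕ (Data.Product.proj₁ e) < toℕ (Data.Product.proj₂ e))
               × ¬ Adjacent E (Data.Product.proj₁ e) (Data.Product.proj₂ e))
    nonadj (x , y) = (toℕ x <? toℕ y) ×-dec ¬? (dec x y ⊎-dec dec y x)

-- ℤ/pℤ as Fin p; addition modulo p.
_+ₚ_ : {p : ℕ} .{{_ : NonZero p}} → Fin p → Fin p → Fin p
_+ₚ_ {p} x y = fromℕ< (m%n<n (toℕ x + toℕ y) p)

Cayley₂ : (p : ℕ) .{{_ : NonZero p}} → Fin p → Fin p → Digraph p
Cayley₂ p a₁ a₂ x y = (y ≡ x +ₚ a₁) ⊎ (y ≡ x +ₚ a₂)

Cayley₂-dec : (p : ℕ) .{{_ : NonZero p}} (a₁ a₂ : Fin p) →
              ∀ x y → Dec (Cayley₂ p a₁ a₂ x y)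
Cayley₂-dec p a₁ a₂ x y =
  (y ≟ x +ₚ a₁) ⊎-dec (y ≟ x +ₚ a₂)

{-# OPTIONS --safe #-}
-- For a unit c of 𝔽ₚ, order the vertices by the representative of c·x in [0, p).  An edge
-- x → x + a then goes up unless c·x is among the top rₐ = (c·a mod p) values; deleting those rₐ
-- edges for each generator leaves an acyclic graph, so β ≤ r₁ + r₂.  Let b = a₂/a₁ ≠ 0.  A relation
-- i·a₁ + j·a₂ = 0 with i + j ≤ 3 closes a cycle of length i + j, so b ∉ {-1, -2, (p-1)/2}.  If
-- b < (p-1)/2, then c = a₁⁻¹ gives residues 1 and b; otherwise k = p - b ≥ 3 and c = ⌊p/k⌋·a₁⁻¹
-- gives residues ⌊p/k⌋ and p mod k ≠ 0, whose sum is still at most (p-1)/2.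
-- For γ, pick 1 ≤ j ≤ 5 with ±j ∉ ±{a₁, a₂}: the p pairs {x, x + j} are pairwise distinct as p
-- is odd, and none is an edge, so γ ≥ p.
module Submission where

open import Data.Nat
open import Data.Nat.Properties
open import Data.Nat.DivMod
open import Data.Nat.Divisibility using (divides)
open import Data.Nat.Primality using (Prime; prime⇒irreducible)
open import Data.Nat.Coprimality using (prime⇒coprime; coprime-Bézout)
open import Data.Nat.GCD using (module Bézout)
open import Data.Nat.Tactic.RingSolver using (solve-∀)
open import Data.Fin using (Fin; toℕ; zero; suc; inject₁; fromℕ; fromℕ<)
open import Data.Fin.Properties using (toℕ-injective; toℕ<n; toℕ-fromℕ<; injective⇒≤; any?)
open import Data.List using (List; []; _∷_; length; lookup; allFin; concatMap; map; applyUpTo; _++_)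
open import Data.List.Properties using (length-++; length-applyUpTo)
open import Data.List.Membership.Propositional using (_∈_; _∉_)
open import Data.List.Membership.Propositional.Properties
  using (∈-filter⁺; ∈-concatMap⁺; ∈-map⁺; ∈-allFin; ∈-applyUpTo⁺; ∈-++⁺ˡ; ∈-++⁺ʳ)
open import Data.List.Membership.DecPropositional _≟_ using (_∈?_; _∉?_)
open import Data.List.Relation.Unary.Any using (index; here; there)
import Data.List.Relation.Unary.Any as Any
open import Data.List.Relation.Unary.Any.Properties using (lookup-index)
import Data.List.Relation.Unary.All.Properties as All
open import Data.Vec using (Vec; []; _∷_)
import Data.Vec as Vec
open import Data.Vec.Properties using (map-++; sum-++)
open import Data.Vec.Relation.Unary.All using ([]; _∷_) renaming (All to AllVec)
open import Data.Vec.Relation.Unary.All.Properties using (lookup⁺) renaming (++⁺ to ++⁺-AllVec)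
open import Data.Product using (∃; _×_; _,_; proj₁; proj₂)
open import Data.Sum using (_⊎_; inj₁; inj₂; swap; [_,_])
import Data.Sum as Sum
open import Data.Empty using (⊥-elim)
open import Function using (_∘_; id; Injective)
open import Relation.Nullary using (¬_; Dec; yes; no; contradiction)
open import Relation.Nullary.Decidable using (decidable-stable)
open import Relation.Binary.Definitions using (tri<; tri≈; tri>)
open import Relation.Binary.PropositionalEquality hiding ([_])
open import Defs

module Congruence (p : ℕ) .{{_ : NonZero p}} where

  infix 4 _≡ₚ_
  _≡ₚ_ : ℕ → ℕ → Set
  m ≡ₚ n = m % p ≡ n % p

  %-≡ₚ : ∀ m → m % p ≡ₚ m
  %-≡ₚ m = m%n%n≡m%n m p

  +-congₚ : ∀ {m m′ n n′} → m ≡ₚ m′ → n ≡ₚ n′ → m + n ≡ₚ m′ + n′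
  +-congₚ {m} {m′} {n} {n′} m≡m′ n≡n′ = begin
    (m + n) % p              ≡⟨ %-distribˡ-+ m n p ⟩
    (m % p + n % p) % p      ≡⟨ cong₂ (λ a b → (a + b) % p) m≡m′ n≡n′ ⟩
    (m′ % p + n′ % p) % p    ≡⟨ %-distribˡ-+ m′ n′ p ⟨
    (m′ + n′) % p            ∎
    where open ≡-Reasoning

  *-congₚ : ∀ {m m′ n n′} → m ≡ₚ m′ → n ≡ₚ n′ → m * n ≡ₚ m′ * n′
  *-congₚ {m} {m′} {n} {n′} m≡m′ n≡n′ = begin
    (m * n) % p              ≡⟨ %-distribˡ-* m n p ⟩
    (m % p * (n % p)) % p    ≡⟨ cong₂ (λ a b → (a * b) % p) m≡m′ n≡n′ ⟩
    (m′ % p * (n′ % p)) % p  ≡⟨ %-distribˡ-* m′ n′ p ⟨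
    (m′ * n′) % p            ∎
    where open ≡-Reasoning

  ≡0⇒≡ₚ0 : ∀ {m} → m % p ≡ 0 → m ≡ₚ 0
  ≡0⇒≡ₚ0 m%p≡0 = trans m%p≡0 (sym (m<n⇒m%n≡m (>-nonZero⁻¹ p)))

  *p≡ₚ0 : ∀ m → m * p ≡ₚ 0
  *p≡ₚ0 m = ≡0⇒≡ₚ0 (m*n%n≡0 m p)

  ≡ₚ⇒≡ : ∀ {m n} → m < p → n < p → m ≡ₚ n → m ≡ n
  ≡ₚ⇒≡ m<p n<p m≡n = trans (sym (m<n⇒m%n≡m m<p)) (trans m≡n (m<n⇒m%n≡m n<p))

  +-cancelˡ-≡ₚ : ∀ x {m n} → x + m ≡ₚ x + n → m ≡ₚ n
  +-cancelˡ-≡ₚ x {m} {n} x+m≡x+n = begin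
    m % p                    ≡⟨ +-congₚ {0} {x′ + x} (sym x′+x≡0) refl ⟩
    (x′ + x + m) % p         ≡⟨ cong (_% p) (+-assoc x′ x m) ⟩
    (x′ + (x + m)) % p       ≡⟨ +-congₚ {x′} refl x+m≡x+n ⟩
    (x′ + (x + n)) % p       ≡⟨ cong (_% p) (+-assoc x′ x n) ⟨
    (x′ + x + n) % p         ≡⟨ +-congₚ {x′ + x} {0} x′+x≡0 refl ⟩
    n % p                    ∎
    where
    open ≡-Reasoning
    x′ : ℕ
    x′ = p ∸ x % p
    x′+x≡0 : x′ + x ≡ₚ 0
    x′+x≡0 = begin
      (x′ + x) % p           ≡⟨ +-congₚ {x′} refl (%-≡ₚ x) ⟨
      (x′ + x % p) % p       ≡⟨ cong (_% p) (m∸n+n≡m (m%n≤n x p)) ⟩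
      p % p                  ≡⟨ ≡0⇒≡ₚ0 (n%n≡0 p) ⟩
      0 % p                  ∎

  ≡ₚ0⇒≡0⊎≡p : ∀ {m} → m < p + p → m ≡ₚ 0 → m ≡ 0 ⊎ m ≡ p
  ≡ₚ0⇒≡0⊎≡p {m} m<2p m≡0 with m <? p
  ... | yes m<p = inj₁ (≡ₚ⇒≡ m<p (>-nonZero⁻¹ p) m≡0)
  ... | no m≮p = inj₂ (begin
    m            ≡⟨ m∸n+n≡m p≤m ⟨
    m ∸ p + p    ≡⟨ cong (_+ p) m∸p≡0 ⟩
    p            ∎)
    where
    open ≡-Reasoning
    p≤m : p ≤ m
    p≤m = ≮⇒≥ m≮p
    m∸p≡0 : m ∸ p ≡ 0
    m∸p≡0 = ≡ₚ⇒≡ (m<n+o⇒m∸n<o m p m<2p) (>-nonZero⁻¹ p) (begin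
      (m ∸ p) % p          ≡⟨ [m+n]%n≡m%n (m ∸ p) p ⟨
      (m ∸ p + p) % p      ≡⟨ cong (_% p) (m∸n+n≡m p≤m) ⟩
      m % p                ≡⟨ m≡0 ⟩
      0 % p                ∎)

  toℕ-+ₚ : ∀ (x y : Fin p) → toℕ (x +ₚ y) ≡ₚ toℕ x + toℕ y
  toℕ-+ₚ x y = trans (cong (_% p) (toℕ-fromℕ< (m%n<n (toℕ x + toℕ y) p))) (%-≡ₚ _)

  toℕ-≡ₚ⇒≡ : ∀ {x y : Fin p} → toℕ x ≡ₚ toℕ y → x ≡ y
  toℕ-≡ₚ⇒≡ {x} {y} = toℕ-injective ∘ ≡ₚ⇒≡ (toℕ<n x) (toℕ<n y)

  +ₚ-≡⇒≡ₚ : ∀ x a {y : Fin p} → x +ₚ a ≡ y → toℕ x + toℕ a ≡ₚ toℕ y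
  +ₚ-≡⇒≡ₚ x a refl = sym (toℕ-+ₚ x a)

  +ₚ-cancelˡ : ∀ {x a b : Fin p} → x +ₚ a ≡ x +ₚ b → a ≡ b
  +ₚ-cancelˡ {x} {a} {b} x+a≡x+b =
    toℕ-≡ₚ⇒≡ (+-cancelˡ-≡ₚ (toℕ x) (trans (+ₚ-≡⇒≡ₚ x a x+a≡x+b) (toℕ-+ₚ x b)))

  +ₚ-≡-self : ∀ {x a : Fin p} → x +ₚ a ≡ x → toℕ a ≡ 0
  +ₚ-≡-self {x} {a} x+a≡x = ≡ₚ⇒≡ (toℕ<n a) (>-nonZero⁻¹ p)
    (+-cancelˡ-≡ₚ (toℕ x) (trans (+ₚ-≡⇒≡ₚ x a x+a≡x) (cong (_% p) (sym (+-identityʳ (toℕ x))))))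

  +ₚ-+ₚ-≡-self : ∀ {x a b : Fin p} → (x +ₚ a) +ₚ b ≡ x → toℕ a + toℕ b ≡ 0 ⊎ toℕ a + toℕ b ≡ p
  +ₚ-+ₚ-≡-self {x} {a} {b} x+a+b≡x =
    ≡ₚ0⇒≡0⊎≡p (+-mono-< (toℕ<n a) (toℕ<n b)) (+-cancelˡ-≡ₚ (toℕ x) (begin
      (toℕ x + (toℕ a + toℕ b)) % p  ≡⟨ cong (_% p) (+-assoc (toℕ x) (toℕ a) (toℕ b)) ⟨
      (toℕ x + toℕ a + toℕ b) % p    ≡⟨ +-congₚ (+ₚ-≡⇒≡ₚ x a refl) refl ⟩
      (toℕ (x +ₚ a) + toℕ b) % p     ≡⟨ +ₚ-≡⇒≡ₚ (x +ₚ a) b x+a+b≡x ⟩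
      toℕ x % p                      ≡⟨ cong (_% p) (+-identityʳ (toℕ x)) ⟨
      (toℕ x + 0) % p                ∎))
    where open ≡-Reasoning

  inverse : Prime p → ∀ {a} → a % p ≢ 0 → ∃ λ d → d * a ≡ₚ 1
  inverse p-prime {a} a≢0 with coprime-Bézout (prime⇒coprime p-prime {{≢-nonZero a≢0}} (m%n<n a p))
  ... | Bézout.-+ x y 1+xp≡ya = y , (begin
    (y * a) % p              ≡⟨ *-congₚ {y} refl (%-≡ₚ a) ⟨
    (y * (a % p)) % p        ≡⟨ cong (_% p) 1+xp≡ya ⟨
    (1 + x * p) % p          ≡⟨ [m+kn]%n≡m%n 1 x p ⟩
    1 % p                    ∎)
    where open ≡-Reasoning
  ... | Bézout.+- x y 1+ya≡xp = y * t , (begin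
    (y * t * a) % p          ≡⟨ *-congₚ {y * t} refl (%-≡ₚ a) ⟨
    (y * t * (a % p)) % p    ≡⟨ cong (_% p) (square y (a % p)) ⟩
    (t * t) % p              ≡⟨ [m+kn]%n≡m%n (t * t) (2 * x) p ⟨
    (t * t + 2 * x * p) % p  ≡⟨ cong (_% p) t²+2xp≡1+x²p² ⟩
    (1 + x * x * p * p) % p  ≡⟨ [m+kn]%n≡m%n 1 (x * x * p) p ⟩
    1 % p                    ∎)
    where
    open ≡-Reasoning
    -- t ≡ -1 (mod p), hence t * t ≡ 1.
    t : ℕ
    t = y * (a % p)
    square : ∀ y a → y * (y * a) * a ≡ y * a * (y * a)
    square = solve-∀
    t²+2xp≡1+x²p² : t * t + 2 * x * p ≡ 1 + x * x * p * p
    t²+2xp≡1+x²p² = begin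
      t * t + 2 * x * p        ≡⟨ cong (t * t +_) (*-assoc 2 x p) ⟩
      t * t + 2 * (x * p)      ≡⟨ cong (λ z → t * t + 2 * z) 1+ya≡xp ⟨
      t * t + 2 * (1 + t)      ≡⟨ complete-square t ⟩
      (1 + t) * (1 + t) + 1    ≡⟨ cong (λ z → z * z + 1) 1+ya≡xp ⟩
      x * p * (x * p) + 1      ≡⟨ regroup x p ⟩
      1 + x * x * p * p        ∎
      where
      complete-square : ∀ t → t * t + 2 * (1 + t) ≡ (1 + t) * (1 + t) + 1
      complete-square = solve-∀
      regroup : ∀ x p → x * p * (x * p) + 1 ≡ 1 + x * x * p * p
      regroup = solve-∀

odd-prime : ∀ {p} → Prime p → 2 < p → p ≡ suc (2 * ((p ∸ 1) / 2))
odd-prime {p} p-prime 2<p with p % 2 | m%n<n p 2 | m≡m%n+[m/n]*n p 2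
... | 0 | _ | p≡m*2 with prime⇒irreducible p-prime (divides (p / 2) p≡m*2)
...   | inj₁ ()
...   | inj₂ 2≡p = contradiction 2≡p (<⇒≢ 2<p)
odd-prime {p} p-prime 2<p | 1 | _ | p≡1+m*2 = begin
  p                          ≡⟨ p≡1+m*2 ⟩
  suc (m * 2)                ≡⟨ cong suc (*-comm m 2) ⟩
  suc (2 * m)                ≡⟨ cong (λ n → suc (2 * n)) (m*n/n≡m m 2) ⟨
  suc (2 * (m * 2 / 2))      ≡⟨ cong (λ n → suc (2 * ((n ∸ 1) / 2))) p≡1+m*2 ⟨
  suc (2 * ((p ∸ 1) / 2))    ∎
  where
  open ≡-Reasoning
  m : ℕ
  m = p / 2
odd-prime p-prime 2<p | suc (suc _) | s≤s (s≤s ()) | _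

half-≤ : ∀ {n m} → 2 * n ≤ suc (2 * m) → n ≤ m
half-≤ {n} {m} 2n≤1+2m = s≤s⁻¹ (*-cancelˡ-< 2 n (suc m) (begin-strict
  2 * n            ≤⟨ 2n≤1+2m ⟩
  suc (2 * m)      <⟨ n<1+n _ ⟩
  2 + 2 * m        ≡⟨ *-suc 2 m ⟨
  2 * suc m        ∎))
  where open ≤-Reasoning

quotient+remainder≤half : ∀ {p m q k s} → p ≡ suc (2 * m) → p ≡ s + q * k → 2 ≤ q → 3 ≤ k → s < k →
                          q + s ≤ m
quotient+remainder≤half {p} {m} {q} {k} {s} p≡1+2m p≡s+qk 2≤q 3≤k s<k = half-≤ (begin
  2 * (q + s)      ≡⟨ distribute q s ⟩
  2 * q + s + s    ≤⟨ +-monoˡ-≤ s (2q+s≤qk 2≤q 3≤k s<k) ⟩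
  q * k + s        ≡⟨ +-comm (q * k) s ⟩
  s + q * k        ≡⟨ trans (sym p≡s+qk) p≡1+2m ⟩
  suc (2 * m)      ∎)
  where
  open ≤-Reasoning
  distribute : ∀ q s → 2 * (q + s) ≡ 2 * q + s + s
  distribute = solve-∀
  2q+s≤qk : 2 ≤ q → 3 ≤ k → s < k → 2 * q + s ≤ q * k
  2q+s≤qk (s≤s (s≤s {n = q′} _)) (s≤s (s≤s (s≤s {n = k′} _))) s<k = begin
    2 * (2 + q′) + s                                ≤⟨ +-monoʳ-≤ (2 * (2 + q′)) (s≤s⁻¹ s<k) ⟩
    2 * (2 + q′) + (2 + k′)                         ≤⟨ m≤m+n _ (q′ + k′ + q′ * k′) ⟩
    2 * (2 + q′) + (2 + k′) + (q′ + k′ + q′ * k′)   ≡⟨ expand q′ k′ ⟩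
    (2 + q′) * (3 + k′)                             ∎
    where
    expand : ∀ q k → 2 * (2 + q) + (2 + k) + (q + k + q * k) ≡ (2 + q) * (3 + k)
    expand = solve-∀

SmallResidues : (p : ℕ) .{{_ : NonZero p}} → ℕ → ℕ → ℕ → Set
SmallResidues p m b q = q % p ≢ 0 × (q * b) % p ≢ 0 × q % p + (q * b) % p ≤ m

-- b ≡ -k (mod p), so (p / k) * b ≡ -(p / k) * k = p % k - p.
[p/k]*b%p≡p%k : ∀ {p b k} .{{_ : NonZero p}} .{{_ : NonZero k}} → b + k ≡ p → (p / k * b) % p ≡ p % k
[p/k]*b%p≡p%k {p} {b} {k} b+k≡p = begin
  (q * b) % p                    ≡⟨ [m+kn]%n≡m%n (q * b) 1 p ⟨
  (q * b + 1 * p) % p            ≡⟨ cong (λ n → (q * b + 1 * n) % p) (m≡m%n+[m/n]*n p k) ⟩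
  (q * b + 1 * (s + q * k)) % p  ≡⟨ cong (_% p) (regroup q b s k) ⟩
  (s + q * (b + k)) % p          ≡⟨ cong (λ n → (s + q * n) % p) b+k≡p ⟩
  (s + q * p) % p                ≡⟨ [m+kn]%n≡m%n s q p ⟩
  s % p                          ≡⟨ m<n⇒m%n≡m (<-≤-trans (m%n<n p k) (subst (k ≤_) b+k≡p (m≤n+m k b))) ⟩
  s                              ∎
  where
  open ≡-Reasoning
  q s : ℕ
  q = p / k
  s = p % k
  regroup : ∀ q b s k → q * b + 1 * (s + q * k) ≡ s + q * (b + k)
  regroup = solve-∀

module _ {p : ℕ} .{{_ : NonZero p}} (p-prime : Prime p) {m : ℕ} (p≡1+2m : p ≡ suc (2 * m)) where

  m<p : m < p
  m<p = subst (m <_) (sym p≡1+2m) (s≤s (m≤m+n m (m + 0)))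

  multiplier-above-half : ∀ {b} → m < b → 3 + b ≤ p → ∃ (SmallResidues p m b)
  multiplier-above-half {b} m<b 3+b≤p =
    q , (n>0⇒n≢0 (≤-trans (s≤s z≤n) 2≤q) ∘ trans (sym q%p≡q)) , (s≢0 ∘ trans (sym qb%p≡s)) ,
    subst₂ (λ x y → x + y ≤ m) (sym q%p≡q) (sym qb%p≡s) (quotient+remainder≤half p≡1+2m p≡s+qk 2≤q 3≤k s<k)
    where
    k : ℕ
    k = p ∸ b
    3≤k : 3 ≤ k
    3≤k = m+n≤o⇒m≤o∸n 3 3+b≤p
    instance
      k≢0 : NonZero k
      k≢0 = >-nonZero (≤-trans (s≤s z≤n) 3≤k)
    q s : ℕ
    q = p / k
    s = p % k
    p≡s+qk : p ≡ s + q * k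
    p≡s+qk = m≡m%n+[m/n]*n p k
    s<k : s < k
    s<k = m%n<n p k
    k≤m : k ≤ m
    k≤m = ≤-trans (∸-monoʳ-≤ p m<b) (≤-reflexive (begin
      p ∸ suc m              ≡⟨ cong (_∸ suc m) p≡1+2m ⟩
      m + (m + 0) ∸ m        ≡⟨ m+n∸m≡n m (m + 0) ⟩
      m + 0                  ≡⟨ +-identityʳ m ⟩
      m                      ∎))
      where open ≡-Reasoning
    k<p : k < p
    k<p = ≤-<-trans k≤m m<p
    2≤q : 2 ≤ q
    2≤q = subst (_≤ q) (m*n/n≡m 2 k)
            (/-monoˡ-≤ k (≤-trans (*-monoʳ-≤ 2 k≤m) (≤-trans (n≤1+n _) (≤-reflexive (sym p≡1+2m)))))
    q%p≡q : q % p ≡ q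
    q%p≡q = m<n⇒m%n≡m (m/n<m p k (≤-trans (s≤s (s≤s z≤n)) 3≤k))
    s≢0 : s ≢ 0
    s≢0 s≡0 with prime⇒irreducible p-prime (divides q (trans p≡s+qk (cong (_+ q * k) s≡0)))
    ... | inj₁ k≡1 = <⇒≢ (≤-trans (s≤s (s≤s z≤n)) 3≤k) (sym k≡1)
    ... | inj₂ k≡p = <⇒≢ k<p k≡p
    qb%p≡s : (q * b) % p ≡ s
    qb%p≡s = [p/k]*b%p≡p%k {p} {b} {k} (m+[n∸m]≡n (≤-trans (m≤n+m b 3) 3+b≤p))

  small-residue-multiplier : ∀ {b} → b ≢ 0 → 3 + b ≤ p → b ≢ m → ∃ (SmallResidues p m b)
  small-residue-multiplier {b} b≢0 3+b≤p b≢m with <-cmp b m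
  ... | tri< b<m _ _ = 1 , ((λ ()) ∘ trans (sym 1%p≡1)) , (b≢0 ∘ trans (sym b%p≡b)) ,
                         subst₂ (λ x y → x + y ≤ m) (sym 1%p≡1) (sym b%p≡b) b<m
    where
    1%p≡1 : 1 % p ≡ 1
    1%p≡1 = m<n⇒m%n≡m (≤-<-trans (≤-trans (s≤s z≤n) b<m) m<p)
    b%p≡b : (1 * b) % p ≡ b
    b%p≡b = trans (cong (_% p) (*-identityˡ b)) (m<n⇒m%n≡m (<-trans b<m m<p))
  ... | tri≈ _ b≡m _ = contradiction b≡m b≢m
  ... | tri> _ _ m<b = multiplier-above-half m<b 3+b≤p

module _ {n : ℕ} {E : Digraph n} where

  potential⇒acyclic : (f : Fin n → ℕ) → (∀ {x y} → E x y → f x < f y) → Acyclic E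
  potential⇒acyclic f ascends k cycle = <-irrefl (cong f (sym closed))
    (≤-<-trans (first≤last (f ∘ w ∘ inject₁) (ascends ∘ edges ∘ inject₁)) (ascends (edges (fromℕ k))))
    where
    open DirCycle cycle
    first≤last : ∀ {k} (h : Fin (suc k) → ℕ) → (∀ j → h (inject₁ j) < h (suc j)) → h zero ≤ h (fromℕ k)
    first≤last {zero} h _ = ≤-refl
    first≤last {suc k} h up = ≤-trans (first≤last (h ∘ inject₁) (up ∘ inject₁)) (<⇒≤ (up (fromℕ k)))

injection⇒≤length : ∀ {A : Set} {k} {xs : List A} (f : Fin k → A) →
                    Injective _≡_ _≡_ f → (∀ i → f i ∈ xs) → k ≤ length xs
injection⇒≤length {xs = xs} f f-injective f∈xs = injective⇒≤ λ {i} {j} same-index →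
  f-injective (begin
    f i                         ≡⟨ lookup-index (f∈xs i) ⟩
    lookup xs (index (f∈xs i))  ≡⟨ cong (lookup xs) same-index ⟩
    lookup xs (index (f∈xs j))  ≡⟨ lookup-index (f∈xs j) ⟨
    f j                         ∎)
  where open ≡-Reasoning

∃-∉-between : ∀ (xs : List ℕ) lo → ∃ λ j → lo ≤ j × j ≤ lo + length xs × j ∉ xs
∃-∉-between xs lo with any? (λ (i : Fin (suc (length xs))) → lo + toℕ i ∉? xs)
... | yes (i , i∉xs) = lo + toℕ i , m≤m+n lo (toℕ i) , +-monoʳ-≤ lo (s≤s⁻¹ (toℕ<n i)) , i∉xs
... | no ¬∃∉ = contradiction (injection⇒≤length (λ i → lo + toℕ i)
                     (toℕ-injective ∘ +-cancelˡ-≡ lo _ _)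
                     (λ i → decidable-stable (lo + toℕ i ∈? xs) (λ i∉xs → ¬∃∉ (i , i∉xs)))) (n≮n _)

orderedPair : ∀ {n} → Fin n → Fin n → Fin n × Fin n
orderedPair x y with toℕ x <? toℕ y
... | yes _ = x , y
... | no _ = y , x

orderedPair-injective : ∀ {n} {x y x′ y′ : Fin n} → orderedPair x y ≡ orderedPair x′ y′ →
                        (x ≡ x′ × y ≡ y′) ⊎ (x ≡ y′ × y ≡ x′)
orderedPair-injective {x = x} {y} {x′} {y′} eq with toℕ x <? toℕ y | toℕ x′ <? toℕ y′
... | yes _ | yes _ = inj₁ (cong proj₁ eq , cong proj₂ eq)
... | yes _ | no _  = inj₂ (cong proj₁ eq , cong proj₂ eq)
... | no _  | yes _ = inj₂ (cong proj₂ eq , cong proj₁ eq)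
... | no _  | no _  = inj₁ (cong proj₂ eq , cong proj₁ eq)

module _ {n : ℕ} (E : Digraph n) where

  NonadjacentPair : Fin n × Fin n → Set
  NonadjacentPair (x , y) = toℕ x < toℕ y × ¬ Adjacent E x y

  orderedPair-nonadjacent : ∀ {x y} → x ≢ y → ¬ Adjacent E x y → NonadjacentPair (orderedPair x y)
  orderedPair-nonadjacent {x} {y} x≢y ¬adj with toℕ x <? toℕ y
  ... | yes x<y = x<y , ¬adj
  ... | no x≮y  = ≤∧≢⇒< (≮⇒≥ x≮y) (x≢y ∘ sym ∘ toℕ-injective) , ¬adj ∘ swap

  ∈-allPairs : ∀ x y → (x , y) ∈ concatMap (λ x → map (λ y → x , y) (allFin n)) (allFin n)
  ∈-allPairs x y = ∈-concatMap⁺ _ (Any.map (λ { refl → ∈-map⁺ (x ,_) (∈-allFin y) }) (∈-allFin x))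

module _ {n : ℕ} .{{_ : NonZero n}} (E : Digraph n) (E? : ∀ x y → Dec (E x y)) where

  open Congruence n

  n≤γ : (j : Fin n) → toℕ j ≢ 0 → toℕ j + toℕ j ≢ n → (∀ x → ¬ Adjacent E x (x +ₚ j)) → n ≤ γ E E?
  n≤γ j j≢0 2j≢n nonadjacent = injection⇒≤length pair pair-injective λ x →
    -- γ filters with a decision procedure local to its definition; unification supplies it.
    ∈-filter⁺ _ (∈-allPairs E _ _) (orderedPair-nonadjacent E (j≢0 ∘ +ₚ-≡-self ∘ sym) (nonadjacent x))
    where
    pair : Fin n → Fin n × Fin n
    pair x = orderedPair x (x +ₚ j)
    pair-injective : Injective _≡_ _≡_ pair
    pair-injective eq with orderedPair-injective eq
    ... | inj₁ (x≡x′ , _) = x≡x′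
    ... | inj₂ (refl , x+j≡x′) = ⊥-elim ([ j≢0 ∘ m+n≡0⇒m≡0 _ , 2j≢n ] (+ₚ-+ₚ-≡-self x+j≡x′))

β≤-mono : ∀ {n} {E : Digraph n} {a b} → a ≤ b → β≤ E a → β≤ E b
β≤-mono a≤b (X , X⊆E , |X|≤a , acyclic) = X , X⊆E , ≤-trans |X|≤a a≤b , acyclic

module _ {p : ℕ} .{{_ : NonZero p}} (a₁ a₂ : Fin p) where

  open Congruence p

  Generator : Fin p → Set
  Generator s = s ≡ a₁ ⊎ s ≡ a₂

  walk : ∀ {k} → Fin p → Vec (Fin p) k → Fin (suc k) → Fin p
  walk x ss       zero    = x
  walk x (s ∷ ss) (suc i) = walk (x +ₚ s) ss i

  walk-step : ∀ {k} x (ss : Vec (Fin p) k) j → walk x ss (suc j) ≡ walk x ss (inject₁ j) +ₚ Vec.lookup ss j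
  walk-step x (s ∷ ss) zero    = refl
  walk-step x (s ∷ ss) (suc j) = walk-step (x +ₚ s) ss j

  walk-end : ∀ {k} x (ss : Vec (Fin p) k) → toℕ (walk x ss (fromℕ k)) ≡ₚ toℕ x + Vec.sum (Vec.map toℕ ss)
  walk-end x []       = cong (_% p) (sym (+-identityʳ (toℕ x)))
  walk-end x (s ∷ ss) = begin
    toℕ (walk (x +ₚ s) ss (fromℕ _)) % p         ≡⟨ walk-end (x +ₚ s) ss ⟩
    (toℕ (x +ₚ s) + Σss) % p                     ≡⟨ +-congₚ (toℕ-+ₚ x s) refl ⟩
    (toℕ x + toℕ s + Σss) % p                    ≡⟨ cong (_% p) (+-assoc (toℕ x) (toℕ s) Σss) ⟩
    (toℕ x + (toℕ s + Σss)) % p                  ∎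
    where
    open ≡-Reasoning
    Σss : ℕ
    Σss = Vec.sum (Vec.map toℕ ss)

  closed-walk⇒cycle : ∀ {k} x (ss : Vec (Fin p) k) → AllVec Generator ss → Vec.sum (Vec.map toℕ ss) ≡ₚ 0 →
                      DirCycle (Cayley₂ p a₁ a₂) k
  closed-walk⇒cycle x ss generators sum≡0 = record
    { w      = walk x ss
    ; edges  = λ j → Sum.map (step j) (step j) (lookup⁺ generators j)
    ; closed = toℕ-≡ₚ⇒≡ (trans (walk-end x ss)
                 (trans (+-congₚ {toℕ x} refl sum≡0) (cong (_% p) (+-identityʳ (toℕ x)))))
    }
    where
    step : ∀ j {a} → Vec.lookup ss j ≡ a → walk x ss (suc j) ≡ walk x ss (inject₁ j) +ₚ a
    step j refl = walk-step x ss j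

  relation⇒cycle : ∀ i j → i * toℕ a₁ + j * toℕ a₂ ≡ₚ 0 → DirCycle (Cayley₂ p a₁ a₂) (i + j)
  relation⇒cycle i j relation = closed-walk⇒cycle a₁ (a₁ⁱ Vec.++ a₂ʲ)
    (++⁺-AllVec (replicate-generators i (inj₁ refl)) (replicate-generators j (inj₂ refl)))
    (trans (cong (_% p) sum-steps) relation)
    where
    open ≡-Reasoning
    a₁ⁱ : Vec (Fin p) i
    a₁ⁱ = Vec.replicate i a₁
    a₂ʲ : Vec (Fin p) j
    a₂ʲ = Vec.replicate j a₂
    replicate-generators : ∀ n {a} → Generator a → AllVec Generator (Vec.replicate n a)
    replicate-generators zero    _         = []
    replicate-generators (suc n) generator = generator ∷ replicate-generators n generator
    sum-replicate : ∀ n a → Vec.sum (Vec.map toℕ (Vec.replicate n a)) ≡ n * toℕ a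
    sum-replicate zero    a = refl
    sum-replicate (suc n) a = cong (toℕ a +_) (sum-replicate n a)
    sum-steps : Vec.sum (Vec.map toℕ (a₁ⁱ Vec.++ a₂ʲ)) ≡ i * toℕ a₁ + j * toℕ a₂
    sum-steps = begin
      Vec.sum (Vec.map toℕ (a₁ⁱ Vec.++ a₂ʲ))                  ≡⟨ cong Vec.sum (map-++ toℕ a₁ⁱ a₂ʲ) ⟩
      Vec.sum (Vec.map toℕ a₁ⁱ Vec.++ Vec.map toℕ a₂ʲ)         ≡⟨ sum-++ (Vec.map toℕ a₁ⁱ) ⟩
      Vec.sum (Vec.map toℕ a₁ⁱ) + Vec.sum (Vec.map toℕ a₂ʲ)    ≡⟨ cong₂ _+_ (sum-replicate i a₁) (sum-replicate j a₂) ⟩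
      i * toℕ a₁ + j * toℕ a₂                                   ∎

module Scaling {p : ℕ} .{{_ : NonZero p}} (c d : ℕ) (d*c≡1 : Congruence._≡ₚ_ p (d * c) 1) where

  open Congruence p

  position : Fin p → ℕ
  position x = (c * toℕ x) % p

  vertexAt : ℕ → Fin p
  vertexAt t = fromℕ< (m%n<n (d * t) p)

  vertexAt-position : ∀ x → vertexAt (position x) ≡ x
  vertexAt-position x = toℕ-≡ₚ⇒≡ (begin
    toℕ (vertexAt (position x)) % p  ≡⟨ cong (_% p) (toℕ-fromℕ< (m%n<n (d * position x) p)) ⟩
    (d * position x) % p % p         ≡⟨ %-≡ₚ (d * position x) ⟩
    (d * position x) % p             ≡⟨ *-congₚ {d} refl (%-≡ₚ (c * toℕ x)) ⟩
    (d * (c * toℕ x)) % p            ≡⟨ cong (_% p) (*-assoc d c (toℕ x)) ⟨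
    (d * c * toℕ x) % p              ≡⟨ *-congₚ d*c≡1 refl ⟩
    (1 * toℕ x) % p                  ≡⟨ cong (_% p) (*-identityˡ (toℕ x)) ⟩
    toℕ x % p                        ∎)
    where open ≡-Reasoning

  residue : Fin p → ℕ
  residue a = (c * toℕ a) % p

  position-+ₚ : ∀ x a → position (x +ₚ a) ≡ (position x + residue a) % p
  position-+ₚ x a = begin
    (c * toℕ (x +ₚ a)) % p           ≡⟨ *-congₚ {c} refl (toℕ-+ₚ x a) ⟩
    (c * (toℕ x + toℕ a)) % p        ≡⟨ cong (_% p) (*-distribˡ-+ c (toℕ x) (toℕ a)) ⟩
    (c * toℕ x + c * toℕ a) % p      ≡⟨ +-congₚ (%-≡ₚ (c * toℕ x)) (%-≡ₚ (c * toℕ a)) ⟨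
    (position x + residue a) % p     ∎
    where open ≡-Reasoning

  wrappingEdge : Fin p → ℕ → Fin p × Fin p
  wrappingEdge a i = let x = vertexAt (p ∸ residue a + i) in x , x +ₚ a

  wrapping : Fin p → List (Fin p × Fin p)
  wrapping a = applyUpTo (wrappingEdge a) (residue a)

  wrapping-or-ascending : ∀ a → residue a ≢ 0 → ∀ x →
                          (x , x +ₚ a) ∈ wrapping a ⊎ position x < position (x +ₚ a)
  wrapping-or-ascending a r≢0 x with position x + residue a <? p
  ... | yes no-wrap = inj₂ (begin-strict
    position x                    <⟨ m<m+n (position x) (n≢0⇒n>0 r≢0) ⟩
    position x + residue a        ≡⟨ m<n⇒m%n≡m no-wrap ⟨
    (position x + residue a) % p  ≡⟨ position-+ₚ x a ⟨
    position (x +ₚ a)             ∎)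
    where open ≤-Reasoning
  ... | no wraps = inj₁ (subst (λ y → (y , y +ₚ a) ∈ wrapping a)
                               (trans (cong vertexAt offset) (vertexAt-position x))
                               (∈-applyUpTo⁺ (wrappingEdge a) offset<residue))
    where
    first : ℕ
    first = p ∸ residue a
    first≤position : first ≤ position x
    first≤position = m≤n+o⇒m∸n≤o p (residue a) (subst (p ≤_) (+-comm (position x) (residue a)) (≮⇒≥ wraps))
    offset : first + (position x ∸ first) ≡ position x
    offset = m+[n∸m]≡n first≤position
    offset<residue : position x ∸ first < residue a
    offset<residue = m<n+o⇒m∸n<o (position x) first {{≢-nonZero r≢0}}
                       (subst (position x <_) (sym (m∸n+n≡m (m%n≤n (c * toℕ a) p))) (m%n<n (c * toℕ x) p))

  β≤-Cayley₂ : ∀ a₁ a₂ → residue a₁ ≢ 0 → residue a₂ ≢ 0 →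
               β≤ (Cayley₂ p a₁ a₂) (residue a₁ + residue a₂)
  β≤-Cayley₂ a₁ a₂ r₁≢0 r₂≢0 =
    wrapping a₁ ++ wrapping a₂ ,
    All.++⁺ (All.applyUpTo⁺₂ (wrappingEdge a₁) (residue a₁) (λ _ → inj₁ refl))
             (All.applyUpTo⁺₂ (wrappingEdge a₂) (residue a₂) (λ _ → inj₂ refl)) ,
    ≤-reflexive (trans (length-++ (wrapping a₁)) (cong₂ _+_ (length-applyUpTo (wrappingEdge a₁) (residue a₁))
                                                           (length-applyUpTo (wrappingEdge a₂) (residue a₂)))) ,
    potential⇒acyclic position ascending
    where
    ascending : ∀ {x y} → (Cayley₂ p a₁ a₂ ∖ (wrapping a₁ ++ wrapping a₂)) x y → position x < position y
    ascending {x} (inj₁ refl , kept) =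
      [ ⊥-elim ∘ kept ∘ ∈-++⁺ˡ , id ] (wrapping-or-ascending a₁ r₁≢0 x)
    ascending {x} (inj₂ refl , kept) =
      [ ⊥-elim ∘ kept ∘ ∈-++⁺ʳ (wrapping a₁) , id ] (wrapping-or-ascending a₂ r₂≢0 x)

module _ {p : ℕ} .{{_ : NonZero p}} (a₁ a₂ : Fin p) where

  open Congruence p

  forbidden : List ℕ
  forbidden = toℕ a₁ ∷ toℕ a₂ ∷ p ∸ toℕ a₁ ∷ p ∸ toℕ a₂ ∷ []

  Cayley₂-nonadjacent : ∀ {j : Fin p} → toℕ j ≢ 0 →
                        (∀ {a} → Generator a₁ a₂ a → j ≢ a × toℕ j + toℕ a ≢ p) →
                        ∀ x → ¬ Adjacent (Cayley₂ p a₁ a₂) x (x +ₚ j)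
  Cayley₂-nonadjacent j≢0 far x (inj₁ (inj₁ x+j≡x+a₁)) = proj₁ (far (inj₁ refl)) (+ₚ-cancelˡ x+j≡x+a₁)
  Cayley₂-nonadjacent j≢0 far x (inj₁ (inj₂ x+j≡x+a₂)) = proj₁ (far (inj₂ refl)) (+ₚ-cancelˡ x+j≡x+a₂)
  Cayley₂-nonadjacent j≢0 far x (inj₂ (inj₁ x≡x+j+a₁)) =
    [ j≢0 ∘ m+n≡0⇒m≡0 _ , proj₂ (far (inj₁ refl)) ] (+ₚ-+ₚ-≡-self (sym x≡x+j+a₁))
  Cayley₂-nonadjacent j≢0 far x (inj₂ (inj₂ x≡x+j+a₂)) =
    [ j≢0 ∘ m+n≡0⇒m≡0 _ , proj₂ (far (inj₂ refl)) ] (+ₚ-+ₚ-≡-self (sym x≡x+j+a₂))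

  Cayley₂-p≤γ : ∀ {m} → p ≡ suc (2 * m) → 5 < p → p ≤ γ (Cayley₂ p a₁ a₂) (Cayley₂-dec p a₁ a₂)
  Cayley₂-p≤γ {m} p≡1+2m 5<p with ∃-∉-between forbidden 1
  ... | j , 1≤j , j≤5 , j∉ =
    n≤γ (Cayley₂ p a₁ a₂) (Cayley₂-dec p a₁ a₂) ĵ ĵ≢0 2ĵ≢p (Cayley₂-nonadjacent ĵ≢0 far)
    where
    ≡∸ : ∀ {j a} → j + a ≡ p → j ≡ p ∸ a
    ≡∸ {j} {a} j+a≡p = trans (sym (m+n∸n≡m j a)) (cong (_∸ a) j+a≡p)
    j<p : j < p
    j<p = ≤-<-trans j≤5 5<p
    ĵ : Fin p
    ĵ = fromℕ< j<p
    ĵ≢0 : toℕ ĵ ≢ 0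
    ĵ≢0 = subst (_≢ 0) (sym (toℕ-fromℕ< j<p)) (n>0⇒n≢0 1≤j)
    2ĵ≢p : toℕ ĵ + toℕ ĵ ≢ p
    2ĵ≢p 2ĵ≡p = even≢odd (toℕ ĵ) m (trans (cong (toℕ ĵ +_) (+-identityʳ (toℕ ĵ))) (trans 2ĵ≡p p≡1+2m))
    ĵ∉ : toℕ ĵ ∉ forbidden
    ĵ∉ = subst (_∉ forbidden) (sym (toℕ-fromℕ< j<p)) j∉
    far : ∀ {a} → Generator a₁ a₂ a → ĵ ≢ a × toℕ ĵ + toℕ a ≢ p
    far (inj₁ refl) = ĵ∉ ∘ here ∘ cong toℕ , ĵ∉ ∘ there ∘ there ∘ here ∘ ≡∸ 
    far (inj₂ refl) = ĵ∉ ∘ there ∘ here ∘ cong toℕ , ĵ∉ ∘ there ∘ there ∘ there ∘ here ∘ ≡∸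

  module Ratio (u : ℕ) (u*a₁≡1 : u * toℕ a₁ ≡ₚ 1) where

    b : ℕ
    b = (u * toℕ a₂) % p

    a₂≡ₚa₁*b : toℕ a₂ ≡ₚ toℕ a₁ * b
    a₂≡ₚa₁*b = sym (begin
      (toℕ a₁ * b) % p              ≡⟨ *-congₚ {toℕ a₁} refl (%-≡ₚ (u * toℕ a₂)) ⟩
      (toℕ a₁ * (u * toℕ a₂)) % p   ≡⟨ cong (_% p) (swap-factors (toℕ a₁) u (toℕ a₂)) ⟩
      (u * toℕ a₁ * toℕ a₂) % p     ≡⟨ *-congₚ u*a₁≡1 refl ⟩
      (1 * toℕ a₂) % p              ≡⟨ cong (_% p) (*-identityˡ (toℕ a₂)) ⟩
      toℕ a₂ % p                    ∎)
      where
      open ≡-Reasoning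
      swap-factors : ∀ x y z → x * (y * z) ≡ y * x * z
      swap-factors = solve-∀

    relation : ∀ i j → i + j * b ≡ p → i * toℕ a₁ + j * toℕ a₂ ≡ₚ 0
    relation i j i+jb≡p = begin
      (i * toℕ a₁ + j * toℕ a₂) % p          ≡⟨ +-congₚ {i * toℕ a₁} refl (*-congₚ {j} refl a₂≡ₚa₁*b) ⟩
      (i * toℕ a₁ + j * (toℕ a₁ * b)) % p    ≡⟨ cong (_% p) (factor i j (toℕ a₁) b) ⟩
      (i + j * b) * toℕ a₁ % p               ≡⟨ cong (λ n → n * toℕ a₁ % p) i+jb≡p ⟩
      p * toℕ a₁ % p                         ≡⟨ cong (_% p) (*-comm p (toℕ a₁)) ⟩
      toℕ a₁ * p % p                         ≡⟨ *p≡ₚ0 (toℕ a₁) ⟩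
      0 % p                                  ∎
      where
      open ≡-Reasoning
      factor : ∀ i j a b → i * a + j * (a * b) ≡ (i + j * b) * a
      factor = solve-∀

    module _ (p-prime : Prime p) {m : ℕ} (p≡1+2m : p ≡ suc (2 * m)) (a₂≢0 : toℕ a₂ ≢ 0)
             (triangle-free : TriangleFree (Cayley₂ p a₁ a₂)) where

      no-digon : ¬ DirCycle (Cayley₂ p a₁ a₂) 2
      no-digon = proj₁ (proj₂ triangle-free)
      no-triangle : ¬ DirCycle (Cayley₂ p a₁ a₂) 3
      no-triangle = proj₂ (proj₂ triangle-free)

      b≢0 : b ≢ 0
      b≢0 b≡0 = a₂≢0 (≡ₚ⇒≡ (toℕ<n a₂) (>-nonZero⁻¹ p)
        (trans a₂≡ₚa₁*b (trans (cong (λ n → toℕ a₁ * n % p) b≡0) (cong (_% p) (*-zeroʳ (toℕ a₁))))))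

      3+b≤p : 3 + b ≤ p
      3+b≤p = ≤∧≢⇒< (≤∧≢⇒< (m%n<n (u * toℕ a₂) p) 1+b≢p) 2+b≢p
        where
        1+b≢p : 1 + b ≢ p
        1+b≢p = no-digon ∘ relation⇒cycle a₁ a₂ 1 1 ∘ relation 1 1 ∘ trans (cong (1 +_) (+-identityʳ b))
        2+b≢p : 2 + b ≢ p
        2+b≢p = no-triangle ∘ relation⇒cycle a₁ a₂ 2 1 ∘ relation 2 1 ∘ trans (cong (2 +_) (+-identityʳ b))

      b≢m : b ≢ m
      b≢m b≡m = no-triangle
        (relation⇒cycle a₁ a₂ 1 2 (relation 1 2 (trans (cong (λ n → suc (2 * n)) b≡m) (sym p≡1+2m))))

      β≤-scaled-by : ∀ {q} → SmallResidues p m b q → β≤ (Cayley₂ p a₁ a₂) m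
      β≤-scaled-by {q} (q%p≢0 , qb%p≢0 , small) =
        β≤-mono (subst₂ (λ x y → x + y ≤ m) (sym residue₁) (sym residue₂) small)
                (β≤-Cayley₂ a₁ a₂ (q%p≢0 ∘ trans (sym residue₁)) (qb%p≢0 ∘ trans (sym residue₂)))
        where
        open ≡-Reasoning
        c : ℕ
        c = q * u
        residue₁ : (c * toℕ a₁) % p ≡ q % p
        residue₁ = begin
          (q * u * toℕ a₁) % p    ≡⟨ cong (_% p) (*-assoc q u (toℕ a₁)) ⟩
          (q * (u * toℕ a₁)) % p  ≡⟨ *-congₚ {q} refl u*a₁≡1 ⟩
          (q * 1) % p             ≡⟨ cong (_% p) (*-identityʳ q) ⟩
          q % p                   ∎
        residue₂ : (c * toℕ a₂) % p ≡ (q * b) % p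
        residue₂ = begin
          (q * u * toℕ a₂) % p    ≡⟨ cong (_% p) (*-assoc q u (toℕ a₂)) ⟩
          (q * (u * toℕ a₂)) % p  ≡⟨ *-congₚ {q} refl (%-≡ₚ (u * toℕ a₂)) ⟨
          (q * b) % p             ∎
        c%p≢0 : c % p ≢ 0
        c%p≢0 c%p≡0 = q%p≢0 (begin
          q % p                       ≡⟨ residue₁ ⟨
          (c * toℕ a₁) % p            ≡⟨ *-congₚ {c % p} (%-≡ₚ c) refl ⟨
          (c % p * toℕ a₁) % p        ≡⟨ cong (λ n → n * toℕ a₁ % p) c%p≡0 ⟩
          0 % p                       ≡⟨ m<n⇒m%n≡m (>-nonZero⁻¹ p) ⟩
          0                           ∎)
        open Scaling c (proj₁ (inverse p-prime c%p≢0)) (proj₂ (inverse p-prime c%p≢0))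

      β≤-half : β≤ (Cayley₂ p a₁ a₂) m
      β≤-half = β≤-scaled-by (proj₂ (small-residue-multiplier p-prime p≡1+2m b≢0 3+b≤p b≢m))

  Cayley₂-β≤ : Prime p → ∀ {m} → p ≡ suc (2 * m) → toℕ a₁ ≢ 0 → toℕ a₂ ≢ 0 →
               TriangleFree (Cayley₂ p a₁ a₂) → β≤ (Cayley₂ p a₁ a₂) m
  Cayley₂-β≤ p-prime p≡1+2m a₁≢0 = Ratio.β≤-half (proj₁ a₁⁻¹) (proj₂ a₁⁻¹) p-prime p≡1+2m
    where
    a₁⁻¹ : ∃ λ u → u * toℕ a₁ ≡ₚ 1
    a₁⁻¹ = inverse p-prime (a₁≢0 ∘ trans (sym (m<n⇒m%n≡m (toℕ<n a₁))))

theorem4 : (p : ℕ) .{{_ : NonZero p}} → Prime p → 7 ≤ p →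
           (a₁ a₂ : Fin p) → ¬ toℕ a₁ ≡ 0 → ¬ toℕ a₂ ≡ 0 → ¬ a₁ ≡ a₂ →
           TriangleFree (Cayley₂ p a₁ a₂) →
           β≤ (Cayley₂ p a₁ a₂) ((p ∸ 1) / 2)
             × (p ∸ 1) / 2 ≤ γ (Cayley₂ p a₁ a₂) (Cayley₂-dec p a₁ a₂) / 2
theorem4 p p-prime 7≤p a₁ a₂ a₁≢0 a₂≢0 _ triangle-free =
  Cayley₂-β≤ a₁ a₂ p-prime p-odd a₁≢0 a₂≢0 triangle-free ,
  /-monoˡ-≤ 2 (≤-trans (m∸n≤m p 1) (Cayley₂-p≤γ a₁ a₂ {m} p-odd (≤-trans (n≤1+n 6) 7≤p)))
  where
  m : ℕ
  m = (p ∸ 1) / 2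
  p-odd : p ≡ suc (2 * m)
  p-odd = odd-prime p-prime (≤-trans (s≤s (s≤s (s≤s z≤n))) 7≤p)
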